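{- Let $(P,\le_P,\mathbf{chain}:P\to[m],\mathbf{color}:P\to\{\alpha,\beta\})$ be a two-color grid poset which decomposes as $P=P_1\triangleleft P_2\triangleleft\cdots\triangleleft P_k$. Let $L=J(P)$ and $L_i=J(P_i)$ ($1\le i\le k$) be the corresponding edge-colored distributive lattices. (1) For every $\gamma\in\{\alpha,\beta\}$ and every $s\in L$, \[\rho_\gamma(s)=\sum_{i=1}^k\rho^{(i)}_\gamma(s\cap P_i),\qquad l_\gamma(s)=\sum_{i=1}^k l^{(i)}_\gamma(s\cap P_i),\qquad wt_L(s)=\sum_{i=1}^k wt_{L_i}(s\cap P_i).\] (2) Consequently, if $M=(M_{\iota,\kappa})_{\iota,\kappa\in\{\alpha,\beta\}}$ is a $2\times2$ matrix such that each $L_i$ satisfies the structure condition for $M$, then $L$ satisfies the structure condition for $M$.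
   Context: For $m\ge1$, $[m]=\{1,\dots,m\}$. A grid poset is a finite poset $P$ with a function $\mathbf{chain}:P\to[m]$ such that each $\mathbf{chain}^{ -1}(i)$ is a (possibly empty) chain of $P$, and whenever $v$ covers $u$ in $P$, either $\mathbf{chain}(u)=\mathbf{chain}(v)$ or $\mathbf{chain}(u)=\mathbf{chain}(v)+1$. A two-color function is $\mathbf{color}:P\to\{\alpha,\beta\}$ that is constant on each $\mathbf{chain}^{ -1}(i)$ and such that $\mathbf{color}(u)\ne\mathbf{color}(v)$ whenever $u,v$ lie in the same connected component of (the Hasse diagram of) $P$ and $\mathbf{chain}(u)=\mathbf{chain}(v)+1$; a grid poset with a two-color function is a two-color grid poset. Decomposition: $P$ decomposes into $P_1\triangleleft P_2$ if $P_1$ is a nonempty order ideal of $P$ with $P_1\ne P$, $P_2=P\setminus P_1$ (both with the induced order), and for every maximal element $u$ of $P_1$ and maximal element $v$ of $P_2$ one has $\mathbf{chain}(u)\le\mathbf{chain}(v)$, and likewise for every minimal element $u$ of $P_1$ and minimal element $v$ of $P_2$. Recursively, $P=P_1\triangleleft P_2\triangleleft\cdots\triangleleft P_k$ ($k\ge2$) means $P=P_1\triangleleft Q$ with $Q=P_2\cup\cdots\cup P_k$ and $Q=P_2\triangleleft\cdots\triangleleft P_k$ (for $k\ge3$), where each piece carries the restrictions of $\mathbf{chain}$ and $\mathbf{color}$ (each $P_i$ is then a two-color grid poset). For a vertex-colored poset $R$, $J(R)$ is the set of order ideals ordered by inclusion, with a cover $s\subset t$, $t\setminus s=\{u\}$,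 colored by $\mathbf{color}(u)$. For $s\in L=J(P)$ and $\gamma\in\{\alpha,\beta\}$, let $\mathrm{comp}_\gamma(s)$ be the connected component of $s$ in the graph on $L$ whose edges are the $\gamma$-colored covers; $\rho_\gamma(s)=|s|-\min_{u\in\mathrm{comp}_\gamma(s)}|u|$, $l_\gamma(s)=\max_{u\in\mathrm{comp}_\gamma(s)}|u|-\min_{u\in\mathrm{comp}_\gamma(s)}|u|$, and $wt_L(s)=(2\rho_\alpha(s)-l_\alpha(s),\,2\rho_\beta(s)-l_\beta(s))\in\mathbb Z^2$. The analogous quantities for $L_i=J(P_i)$ are denoted $\rho^{(i)}_\gamma$, $l^{(i)}_\gamma$, $wt_{L_i}$; note $s\cap P_i$ is an order ideal of $P_i$. An edge-colored lattice $L$ satisfies the structure condition for $M$ if whenever $t$ covers $s$ with color $\gamma$, $wt_L(t)=wt_L(s)+(M_{\gamma,\alpha},M_{\gamma,\beta})$. -}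

module Defs where

open import Level using (0ℓ)
open import Data.Nat as ℕ using (ℕ; zero; suc)
open import Data.Integer as ℤ using (ℤ; +_)
open import Data.Fin as Fin using (Fin; toℕ)
open import Data.Fin.Subset using (Subset; _∈_; _∉_; _⊆_; _∪_; _∩_; _─_; ⁅_⁆; ∣_∣; Nonempty; ⊤)
open import Data.Vec using (Vec; []; _∷_; foldr)
open import Data.Product using (Σ; ∃; _×_; _,_; proj₁; proj₂)
open import Data.Empty using () renaming (⊥ to Empty)
open import Data.Sum using (_⊎_)
open import Relation.Binary using (Rel; IsDecPartialOrder)
open import Relation.Binary.PropositionalEquality using (_≡_; _≢_)
open import Relation.Binary.Construct.Closure.ReflexiveTransitive using (Star)

data Color : Set where
  α β : Color

Covers : ∀ {n} → Rel (Fin n) 0ℓ → Fin n → Fin n → Set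
Covers R u v = R u v × u ≢ v × (∀ w → R u w → R w v → w ≡ u ⊎ w ≡ v)

HasseConnected : ∀ {n} → Rel (Fin n) 0ℓ → Fin n → Fin n → Set
HasseConnected R = Star (λ u v → Covers R u v ⊎ Covers R v u)

-- A two-color grid poset with elements Fin n and chains labelled by Fin m
-- (label i : Fin m stands for chain number toℕ i + 1 ∈ [m]).
record TwoColorGridPoset (n m : ℕ) : Set₁ where
  field
    R        : Rel (Fin n) 0ℓ
    isDecPO  : IsDecPartialOrder _≡_ R
    chain    : Fin n → Fin m
    color    : Fin n → Color
    chainIsChain : ∀ u v → chain u ≡ chain v → R u v ⊎ R v u
    coverChain   : ∀ u v → Covers R u v →
                   chain u ≡ chain v ⊎ toℕ (chain u) ≡ suc (toℕ (chain v))
    colorConst   : ∀ u v → chain u ≡ chain v → color u ≡ color v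
    colorAlt     : ∀ u v → HasseConnected R u v →
                   toℕ (chain u) ≡ suc (toℕ (chain v)) → color u ≢ color v

module _ {n m : ℕ} (P : TwoColorGridPoset n m) where
  open TwoColorGridPoset P

  -- Subposets with the induced order are given by subsets S of Fin n.

  IsIdeal : Subset n → Subset n → Set
  IsIdeal S A = A ⊆ S × (∀ u v → v ∈ A → u ∈ S → R u v → u ∈ A)

  IsMaximalIn : Subset n → Fin n → Set
  IsMaximalIn A u = u ∈ A × (∀ w → w ∈ A → R u w → w ≡ u)

  IsMinimalIn : Subset n → Fin n → Set
  IsMinimalIn A u = u ∈ A × (∀ w → w ∈ A → R w u → w ≡ u)

  Decomp₂ : Subset n → Subset n → Set
  Decomp₂ Q A =
      IsIdeal Q A × Nonempty A × A ≢ Q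
    × (∀ u v → IsMaximalIn A u → IsMaximalIn (Q ─ A) v → toℕ (chain u) ℕ.≤ toℕ (chain v))
    × (∀ u v → IsMinimalIn A u → IsMinimalIn (Q ─ A) v → toℕ (chain u) ℕ.≤ toℕ (chain v))

  Decomp : ∀ {k} → Subset n → Vec (Subset n) k → Set
  Decomp Q (A ∷ B ∷ [])       = Decomp₂ Q A × B ≡ Q ─ A
  Decomp Q (A ∷ B ∷ C ∷ rest) = Decomp₂ Q A × Decomp (Q ─ A) (B ∷ C ∷ rest)
  Decomp Q _                  = Empty

  JCover : Subset n → Subset n → Subset n → Fin n → Set
  JCover S s t u = IsIdeal S s × IsIdeal S t × u ∉ s × t ≡ s ∪ ⁅ u ⁆

  Step : Subset n → Color → Subset n → Subset n → Set
  Step S γ s t = (Σ (Fin n) λ u → JCover S s t u × color u ≡ γ)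
               ⊎ (Σ (Fin n) λ u → JCover S t s u × color u ≡ γ)

  InComp : Subset n → Color → Subset n → Subset n → Set
  InComp S γ = Star (Step S γ)

  IsMinSize : Subset n → Color → Subset n → ℕ → Set
  IsMinSize S γ s k = (∃ λ u → InComp S γ s u × ∣ u ∣ ≡ k)
                    × (∀ u → InComp S γ s u → k ℕ.≤ ∣ u ∣)

  IsMaxSize : Subset n → Color → Subset n → ℕ → Set
  IsMaxSize S γ s K = (∃ λ u → InComp S γ s u × ∣ u ∣ ≡ K)
                    × (∀ u → InComp S γ s u → ∣ u ∣ ℕ.≤ K)

  IsRho : Subset n → Color → Subset n → ℕ → Set
  IsRho S γ s r = ∃ λ k → IsMinSize S γ s k × r ℕ.+ k ≡ ∣ s ∣

  IsLen : Subset n → Color → Subset n → ℕ → Set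
  IsLen S γ s l = ∃ λ k → ∃ λ K → IsMinSize S γ s k × IsMaxSize S γ s K × l ℕ.+ k ≡ K

  IsWt : Subset n → Subset n → ℤ × ℤ → Set
  IsWt S s (x , y) = ∃ λ rα → ∃ λ lα → ∃ λ rβ → ∃ λ lβ →
      IsRho S α s rα × IsLen S α s lα × IsRho S β s rβ × IsLen S β s lβ
    × x ≡ (+ (2 ℕ.* rα)) ℤ.- (+ lα) × y ≡ (+ (2 ℕ.* rβ)) ℤ.- (+ lβ)

  StructCond : Subset n → (Color → Color → ℤ) → Set
  StructCond S M = ∀ s t u γ → JCover S s t u → color u ≡ γ →
    ∀ x y x' y' → IsWt S s (x , y) → IsWt S t (x' , y') →
    x' ≡ x ℤ.+ M γ α × y' ≡ y ℤ.+ M γ β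

sumℕ : ∀ {k} → (Fin k → ℕ) → ℕ
sumℕ {zero}  f = 0
sumℕ {suc k} f = f Fin.zero ℕ.+ sumℕ (λ i → f (Fin.suc i))

sumWt : ∀ {k} → (Fin k → ℤ × ℤ) → ℤ × ℤ
sumWt {zero}  f = (+ 0 , + 0)
sumWt {suc k} f =
  ( proj₁ (f Fin.zero) ℤ.+ proj₁ (sumWt (λ i → f (Fin.suc i)))
  , proj₂ (f Fin.zero) ℤ.+ proj₂ (sumWt (λ i → f (Fin.suc i))) )

module Submission where

-- (i) For an ideal s of a subposet Q, comp_γ(s) consists of the ideals agreeing with s on all
-- elements not colored γ; its least member minIdeal is the down-closure of the non-γ part of
-- s and it has a greatest member maxIdeal, so ρ_γ(s) = |s| - |minIdeal| and
-- l_γ(s) = |maxIdeal| - |minIdeal| (module Components).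
-- (ii) For Q = A ◁ (Q ─ A) with Q an up-set, minIdeal and maxIdeal restrict to those of s ∩ A
-- and s ∩ (Q ─ A): the chain conditions of ◁ route any relation between the two pieces
-- through an element on the same chain, hence of the same color (modules Grid, Additivity).
-- (iii) So ρ_γ, l_γ, wt add up over A ◁ (Q ─ A), and by induction over P₁ ◁ ⋯ ◁ P_k; a cover
-- of J(Q) adds a single element, which lies in one piece, so the weight shift of J(Q) is
-- that of one J(P_i) (module Weights).

open import Defs
open import Data.Nat using (ℕ)
open import Data.Integer using (ℤ)
open import Data.Fin using (Fin)
open import Data.Fin.Subset using (Subset; ⊤; _∩_)
open import Data.Vec using (Vec; lookup)
open import Data.Product using (_×_)
open import Relation.Binary.PropositionalEquality using (_≡_)

open import Level using (0ℓ)
open import Data.Nat as ℕ using (zero; suc; _+_; _∸_; _*_; _≤_; _<_)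
import Data.Nat.Properties as ℕP
open import Data.Nat.Induction using (<-wellFounded)
import Data.Integer as ℤ
import Data.Integer.Properties as ℤP
open import Data.Integer.Tactic.RingSolver using (solve-∀)
open import Data.Fin using (toℕ; zero; suc)
open import Data.Fin.Properties using (_≟_; toℕ-injective; any?; all?)
open import Data.Fin.Induction using (po-wellFounded)
open import Data.Fin.Subset using (inside; outside; Nonempty; _∈_; _∉_; _⊆_; _∪_; _─_; ⁅_⁆; ∣_∣)
open import Data.Fin.Subset.Properties
  using (_∈?_; nonempty?; ∈⊤; ⊆-antisym; p⊆q⇒∣p∣≤∣q∣; x∈p∩q⁺; x∈p∩q⁻; x∈p∪q⁺; x∈p∪q⁻;
         x∈⁅x⁆; x∈⁅y⁆⇒x≡y; p─q⊆p; x∈p∧x∉q⇒x∈p─q; p─q─r≡p─q∪r; x∈p⇒∣p-x∣<∣p∣)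
open import Data.Vec using ([]; _∷_; tabulate; here; there)
open import Data.Vec.Properties using (lookup∘tabulate; []=⇒lookup; lookup⇒[]=)
open import Data.Product using (∃; _,_; proj₁; proj₂)
open import Data.Sum as Sum using (_⊎_; inj₁; inj₂; [_,_]′)
open import Function using (flip; _∘_)
open import Induction.WellFounded using (Acc; acc)
open import Relation.Nullary using (¬_; Dec; yes; no; does; contradiction)
open import Relation.Nullary.Decidable using (_×-dec_; _→-dec_; ¬?; dec-true; decidable-stable)
open import Relation.Unary using (Pred; Decidable)
open import Relation.Binary using (Rel; IsPartialOrder; IsDecPartialOrder)
import Relation.Binary.Definitions as B
import Relation.Binary.Construct.Flip.EqAndOrd as Flip
open import Relation.Binary.Construct.Closure.ReflexiveTransitive using (ε; _◅_; fold; reverse)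
open import Relation.Binary.PropositionalEquality

private variable n : ℕ

subsetOf : ∀ {ℓ} {Pr : Pred (Fin n) ℓ} → Decidable Pr → Subset n
subsetOf Pr? = tabulate (λ x → does (Pr? x))

module _ {ℓ} {Pr : Pred (Fin n) ℓ} (Pr? : Decidable Pr) where

  ∈subsetOf⁺ : ∀ {x} → Pr x → x ∈ subsetOf Pr?
  ∈subsetOf⁺ {x} px = lookup⇒[]= x _ (trans (lookup∘tabulate _ x) (dec-true (Pr? x) px))

  ∈subsetOf⁻ : ∀ {x} → x ∈ subsetOf Pr? → Pr x
  ∈subsetOf⁻ {x} x∈ with Pr? x | trans (sym (lookup∘tabulate (λ y → does (Pr? y)) x)) ([]=⇒lookup x∈)
  ... | yes px | _  = px
  ... | no  _  | ()

x∈p─q⁻ : ∀ {x : Fin n} (p q : Subset n) → x ∈ p ─ q → x ∈ p × x ∉ q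
x∈p─q⁻ p q x∈ = p─q⊆p p q x∈ , not-in-q p q x∈
  where
  not-in-q : ∀ {n} {x : Fin n} (p q : Subset n) → x ∈ p ─ q → x ∉ q
  not-in-q (inside  ∷ p) (inside ∷ q) ()        here
  not-in-q (outside ∷ p) (inside ∷ q) ()        here
  not-in-q (_       ∷ p) (_      ∷ q) (there h) (there h') = not-in-q p q h h'

x∈p∪⁅y⁆⁻ : ∀ {x : Fin n} (p : Subset n) y → x ∈ p ∪ ⁅ y ⁆ → x ∈ p ⊎ x ≡ y
x∈p∪⁅y⁆⁻ p y x∈ = Sum.map₂ (x∈⁅y⁆⇒x≡y y) (x∈p∪q⁻ p ⁅ y ⁆ x∈)

x∈p⇒x∈p∪⁅y⁆ : ∀ {x : Fin n} {p : Subset n} y → x ∈ p → x ∈ p ∪ ⁅ y ⁆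
x∈p⇒x∈p∪⁅y⁆ y x∈p = x∈p∪q⁺ (inj₁ x∈p)

y∈p∪⁅y⁆ : ∀ {p : Subset n} y → y ∈ p ∪ ⁅ y ⁆
y∈p∪⁅y⁆ y = x∈p∪q⁺ (inj₂ (x∈⁅x⁆ y))

∪⁅⁆-⊆ : ∀ {p q : Subset n} {y} → p ⊆ q → y ∈ q → p ∪ ⁅ y ⁆ ⊆ q
∪⁅⁆-⊆ {p = p} {y = y} p⊆q y∈q x∈ with x∈p∪⁅y⁆⁻ p y x∈
... | inj₁ x∈p  = p⊆q x∈p
... | inj₂ refl = y∈q

─-empty⇒⊆ : ∀ {p q : Subset n} → ¬ Nonempty (q ─ p) → q ⊆ p
─-empty⇒⊆ {p = p} q─p-empty {x} x∈q = decidable-stable (x ∈? p) (λ x∉p → q─p-empty (x , x∈p∧x∉q⇒x∈p─q x∈q x∉p))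

∣p∣≡∣p∩q∣+∣p─q∣ : ∀ (p q : Subset n) → ∣ p ∣ ≡ ∣ p ∩ q ∣ + ∣ p ─ q ∣
∣p∣≡∣p∩q∣+∣p─q∣ []          []          = refl
∣p∣≡∣p∩q∣+∣p─q∣ (inside  ∷ p) (inside  ∷ q) = cong suc (∣p∣≡∣p∩q∣+∣p─q∣ p q)
∣p∣≡∣p∩q∣+∣p─q∣ (inside  ∷ p) (outside ∷ q) =
  trans (cong suc (∣p∣≡∣p∩q∣+∣p─q∣ p q)) (sym (ℕP.+-suc ∣ p ∩ q ∣ ∣ p ─ q ∣))
∣p∣≡∣p∩q∣+∣p─q∣ (outside ∷ p) (inside  ∷ q) = ∣p∣≡∣p∩q∣+∣p─q∣ p q
∣p∣≡∣p∩q∣+∣p─q∣ (outside ∷ p) (outside ∷ q) = ∣p∣≡∣p∩q∣+∣p─q∣ p q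

∣p∣-split : ∀ {p q r r' : Subset n} → p ∩ q ≡ r → p ─ q ≡ r' → ∣ p ∣ ≡ ∣ r ∣ + ∣ r' ∣
∣p∣-split {p = p} {q} refl refl = ∣p∣≡∣p∩q∣+∣p─q∣ p q

∩-⊆-absorb : ∀ (s : Subset n) {p q : Subset n} → p ⊆ q → (s ∩ q) ∩ p ≡ s ∩ p
∩-⊆-absorb s {p} {q} p⊆q = ⊆-antisym
  (λ x∈ → let x∈s∩q , x∈p = x∈p∩q⁻ (s ∩ q) p x∈ in x∈p∩q⁺ (proj₁ (x∈p∩q⁻ s q x∈s∩q) , x∈p))
  (λ x∈ → let x∈s , x∈p = x∈p∩q⁻ s p x∈ in x∈p∩q⁺ (x∈p∩q⁺ (x∈s , p⊆q x∈p) , x∈p))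

∪⁅⁆-∩-inside : ∀ (s : Subset n) {X : Subset n} {u} → u ∈ X → (s ∪ ⁅ u ⁆) ∩ X ≡ (s ∩ X) ∪ ⁅ u ⁆
∪⁅⁆-∩-inside s {X} {u} u∈X = ⊆-antisym to from
  where
  to : (s ∪ ⁅ u ⁆) ∩ X ⊆ (s ∩ X) ∪ ⁅ u ⁆
  to x∈ with x∈p∩q⁻ (s ∪ ⁅ u ⁆) X x∈
  ... | x∈s∪u , x∈X with x∈p∪⁅y⁆⁻ s u x∈s∪u
  ... | inj₁ x∈s = x∈p⇒x∈p∪⁅y⁆ u (x∈p∩q⁺ (x∈s , x∈X))
  ... | inj₂ refl = y∈p∪⁅y⁆ u
  from : (s ∩ X) ∪ ⁅ u ⁆ ⊆ (s ∪ ⁅ u ⁆) ∩ X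
  from x∈ with x∈p∪⁅y⁆⁻ (s ∩ X) u x∈
  ... | inj₁ x∈s∩X = let x∈s , x∈X = x∈p∩q⁻ s X x∈s∩X in x∈p∩q⁺ (x∈p⇒x∈p∪⁅y⁆ u x∈s , x∈X)
  ... | inj₂ refl = x∈p∩q⁺ (y∈p∪⁅y⁆ u , u∈X)

∪⁅⁆-∩-outside : ∀ (s : Subset n) {X : Subset n} {u} → u ∉ X → (s ∪ ⁅ u ⁆) ∩ X ≡ s ∩ X
∪⁅⁆-∩-outside s {X} {u} u∉X = ⊆-antisym to from
  where
  to : (s ∪ ⁅ u ⁆) ∩ X ⊆ s ∩ X
  to x∈ with x∈p∩q⁻ (s ∪ ⁅ u ⁆) X x∈
  ... | x∈s∪u , x∈X with x∈p∪⁅y⁆⁻ s u x∈s∪u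
  ... | inj₁ x∈s = x∈p∩q⁺ (x∈s , x∈X)
  ... | inj₂ refl = contradiction x∈X u∉X
  from : s ∩ X ⊆ (s ∪ ⁅ u ⁆) ∩ X
  from x∈ = let x∈s , x∈X = x∈p∩q⁻ s X x∈ in x∈p∩q⁺ (x∈p⇒x∈p∪⁅y⁆ u x∈s , x∈X)

module Minimal {_⊑_ : Rel (Fin n) 0ℓ} (isPO : IsPartialOrder _≡_ _⊑_) (_⊑?_ : B.Decidable _⊑_) where
  open IsPartialOrder isPO using () renaming (refl to ⊑-refl; trans to ⊑-trans)

  minimal-below : ∀ {ℓ} (S : Pred (Fin n) ℓ) → Decidable S → ∀ {a} → S a →
                  ∃ λ z → S z × z ⊑ a × (∀ w → S w → w ⊑ z → w ≡ z)
  minimal-below S S? {a} = descend (po-wellFounded isPO a)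
    where
    descend : ∀ {a} → Acc (λ x y → x ⊑ y × x ≢ y) a → S a → ∃ λ z → S z × z ⊑ a × (∀ w → S w → w ⊑ z → w ≡ z)
    descend {a} (acc smaller) sa with any? (λ w → S? w ×-dec (w ⊑? a) ×-dec ¬? (w ≟ a))
    ... | yes (w , sw , w⊑a , w≢a) =
      let z , sz , z⊑w , z-min = descend (smaller (w⊑a , w≢a)) sw
      in  z , sz , ⊑-trans z⊑w w⊑a , z-min
    ... | no none = a , sa , ⊑-refl ,
      λ w sw w⊑a → decidable-stable (w ≟ a) (λ w≢a → none (w , sw , w⊑a , w≢a))

module FinitePoset {_⊑_ : Rel (Fin n) 0ℓ} (isPO : IsPartialOrder _≡_ _⊑_) (_⊑?_ : B.Decidable _⊑_) where
  open IsPartialOrder isPO using () renaming (refl to ⊑-refl; trans to ⊑-trans)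
  open Minimal isPO _⊑?_ public

  maximal-above : ∀ {ℓ} (S : Pred (Fin n) ℓ) → Decidable S → ∀ {a} → S a →
                  ∃ λ z → S z × a ⊑ z × (∀ w → S w → z ⊑ w → w ≡ z)
  maximal-above = Minimal.minimal-below (Flip.isPartialOrder isPO) (flip _⊑?_)

  cover-above : ∀ {x y} → x ⊑ y → x ≢ y → ∃ λ z → Covers _⊑_ x z × z ⊑ y
  cover-above {x} {y} x⊑y x≢y
    with minimal-below (λ z → x ⊑ z × x ≢ z × z ⊑ y)
           (λ z → (x ⊑? z) ×-dec ¬? (x ≟ z) ×-dec (z ⊑? y)) (x⊑y , x≢y , ⊑-refl)
  ... | z , (x⊑z , x≢z , z⊑y) , _ , z-min = z , (x⊑z , x≢z , between) , z⊑y
    where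
    between : ∀ w → x ⊑ w → w ⊑ z → w ≡ x ⊎ w ≡ z
    between w x⊑w w⊑z with w ≟ x
    ... | yes w≡x = inj₁ w≡x
    ... | no  w≢x = inj₂ (z-min w (x⊑w , (λ x≡w → w≢x (sym x≡w)) , ⊑-trans w⊑z z⊑y) w⊑z)

  cover-below : ∀ {x y} → x ⊑ y → x ≢ y → ∃ λ z → x ⊑ z × Covers _⊑_ z y
  cover-below {x} {y} x⊑y x≢y
    with maximal-above (λ z → x ⊑ z × z ≢ y × z ⊑ y)
           (λ z → (x ⊑? z) ×-dec ¬? (z ≟ y) ×-dec (z ⊑? y)) (⊑-refl , x≢y , x⊑y)
  ... | z , (x⊑z , z≢y , z⊑y) , _ , z-max = z , x⊑z , (z⊑y , z≢y , between)
    where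
    between : ∀ w → z ⊑ w → w ⊑ y → w ≡ z ⊎ w ≡ y
    between w z⊑w w⊑y with w ≟ y
    ... | yes w≡y = inj₂ w≡y
    ... | no  w≢y = inj₁ (z-max w (⊑-trans x⊑z z⊑w , w≢y , w⊑y) z⊑w)

  maximal-or-covered : ∀ {ℓ} (S : Pred (Fin n) ℓ) → Decidable S → ∀ {x} → S x →
    (∀ w → S w → x ⊑ w → w ≡ x) ⊎ (∃ λ y → Covers _⊑_ x y × ∃ λ w → S w × y ⊑ w)
  maximal-or-covered S S? {x} sx with any? (λ w → S? w ×-dec (x ⊑? w) ×-dec ¬? (x ≟ w))
  ... | yes (w , sw , x⊑w , x≢w) =
    let y , x⋖y , y⊑w = cover-above x⊑w x≢w in inj₂ (y , x⋖y , w , sw , y⊑w)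
  ... | no none = inj₁ λ w sw x⊑w →
    decidable-stable (w ≟ x) (λ w≢x → none (w , sw , x⊑w , λ x≡w → w≢x (sym x≡w)))

  minimal-or-covering : ∀ {ℓ} (S : Pred (Fin n) ℓ) → Decidable S → ∀ {y} → S y →
    (∀ w → S w → w ⊑ y → w ≡ y) ⊎ (∃ λ z → Covers _⊑_ z y × ∃ λ w → S w × w ⊑ z)
  minimal-or-covering S S? {y} sy with any? (λ w → S? w ×-dec (w ⊑? y) ×-dec ¬? (w ≟ y))
  ... | yes (w , sw , w⊑y , w≢y) =
    let z , w⊑z , z⋖y = cover-below w⊑y w≢y in inj₂ (z , z⋖y , w , sw , w⊑z)
  ... | no none = inj₁ λ w sw w⊑y →
    decidable-stable (w ≟ y) (λ w≢y → none (w , sw , w⊑y , w≢y))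

sumℕ-cong : ∀ {k} {f g : Fin k → ℕ} → (∀ i → f i ≡ g i) → sumℕ f ≡ sumℕ g
sumℕ-cong {zero}  f≗g = refl
sumℕ-cong {suc k} f≗g = cong₂ _+_ (f≗g zero) (sumℕ-cong (f≗g ∘ suc))

wtPart : ℕ → ℕ → ℤ
wtPart r l = (ℤ.+ (2 * r)) ℤ.- (ℤ.+ l)

wtPart-+ : ∀ r r' l l' → wtPart (r + r') (l + l') ≡ wtPart r l ℤ.+ wtPart r' l'
wtPart-+ r r' l l' = begin
  (ℤ.+ (2 * (r + r'))) ℤ.- (ℤ.+ (l + l'))                    ≡⟨ cong₂ ℤ._-_ (trans (cong ℤ.+_ (ℕP.*-distribˡ-+ 2 r r'))
                                                                              (ℤP.pos-+ (2 * r) (2 * r')))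
                                                                       (ℤP.pos-+ l l') ⟩
  ((ℤ.+ (2 * r)) ℤ.+ (ℤ.+ (2 * r'))) ℤ.- ((ℤ.+ l) ℤ.+ (ℤ.+ l'))  ≡⟨ interchange (ℤ.+ (2 * r)) (ℤ.+ (2 * r')) (ℤ.+ l) (ℤ.+ l') ⟩
  wtPart r l ℤ.+ wtPart r' l'                            ∎
  where
  open ≡-Reasoning
  interchange : ∀ a b c d → (a ℤ.+ b) ℤ.- (c ℤ.+ d) ≡ (a ℤ.- c) ℤ.+ (b ℤ.- d)
  interchange = solve-∀

_⊕_ : ℤ × ℤ → ℤ × ℤ → ℤ × ℤ
p ⊕ q = (proj₁ p ℤ.+ proj₁ q , proj₂ p ℤ.+ proj₂ q)

⊕-assoc : ∀ p q r → (p ⊕ q) ⊕ r ≡ p ⊕ (q ⊕ r)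
⊕-assoc p q r = cong₂ _,_ (ℤP.+-assoc (proj₁ p) (proj₁ q) (proj₁ r)) (ℤP.+-assoc (proj₂ p) (proj₂ q) (proj₂ r))

⊕-swapʳ : ∀ p q r → (p ⊕ r) ⊕ q ≡ (p ⊕ q) ⊕ r
⊕-swapʳ p q r = cong₂ _,_ (swap (proj₁ p) (proj₁ q) (proj₁ r)) (swap (proj₂ p) (proj₂ q) (proj₂ r))
  where
  swap : ∀ a b c → (a ℤ.+ c) ℤ.+ b ≡ (a ℤ.+ b) ℤ.+ c
  swap = solve-∀

sumWt-wtPart : ∀ {k} (a b c d : Fin k → ℕ) →
  sumWt (λ i → (wtPart (a i) (b i) , wtPart (c i) (d i))) ≡ (wtPart (sumℕ a) (sumℕ b) , wtPart (sumℕ c) (sumℕ d))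
sumWt-wtPart {zero}  a b c d = refl
sumWt-wtPart {suc k} a b c d =
  trans (cong ((wtPart (a zero) (b zero) , wtPart (c zero) (d zero)) ⊕_)
              (sumWt-wtPart (a ∘ suc) (b ∘ suc) (c ∘ suc) (d ∘ suc)))
        (sym (cong₂ _,_ (wtPart-+ (a zero) (sumℕ (a ∘ suc)) (b zero) (sumℕ (b ∘ suc)))
                        (wtPart-+ (c zero) (sumℕ (c ∘ suc)) (d zero) (sumℕ (d ∘ suc)))))

sumWt-cong : ∀ {k} {f g : Fin k → ℤ × ℤ} → (∀ i → f i ≡ g i) → sumWt f ≡ sumWt g
sumWt-cong {zero}  f≗g = refl
sumWt-cong {suc k} f≗g = cong₂ _⊕_ (f≗g zero) (sumWt-cong (f≗g ∘ suc))

_≟ᶜ_ : (γ δ : Color) → Dec (γ ≡ δ)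
α ≟ᶜ α = yes refl
α ≟ᶜ β = no λ ()
β ≟ᶜ α = no λ ()
β ≟ᶜ β = yes refl

module Grid {n m : ℕ} (P : TwoColorGridPoset n m) where
  open TwoColorGridPoset P
  open IsDecPartialOrder isDecPO using (_≤?_)
    renaming (isPartialOrder to R-isPO; refl to R-refl; trans to R-trans)
  open FinitePoset R-isPO _≤?_

  ch : Fin n → ℕ
  ch u = toℕ (chain u)

  cover-chain : ∀ {x y} → Covers R x y → ch y ≤ ch x × ch x ≤ suc (ch y)
  cover-chain {x} {y} x⋖y with coverChain x y x⋖y
  ... | inj₁ same = ℕP.≤-reflexive (cong toℕ (sym same)) , ℕP.m≤n⇒m≤1+n (ℕP.≤-reflexive (cong toℕ same))
  ... | inj₂ next = ℕP.≤-trans (ℕP.n≤1+n (ch y)) (ℕP.≤-reflexive (sym next)) , ℕP.≤-reflexive next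

  chain-antitone : ∀ {x y} → R x y → ch y ≤ ch x
  chain-antitone {x} {y} = descend (po-wellFounded R-isPO y)
    where
    descend : ∀ {y} → Acc (λ a b → R a b × a ≢ b) y → R x y → ch y ≤ ch x
    descend {y} (acc smaller) x≤y with x ≟ y
    ... | yes refl = ℕP.≤-refl
    ... | no  x≢y =
      let z , x≤z , z⋖y = cover-below x≤y x≢y
      in  ℕP.≤-trans (proj₁ (cover-chain z⋖y)) (descend (smaller (proj₁ z⋖y , proj₁ (proj₂ z⋖y))) x≤z)

  -- Up-sets of P: the successive remainders P_j ∪ ⋯ ∪ P_k of a decomposition are of this form.
  UpSet : Subset n → Set
  UpSet Q = ∀ {x y} → x ∈ Q → R x y → y ∈ Q

  ⊤-up : UpSet ⊤
  ⊤-up _ _ = ∈⊤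

  module TwoPieces {Q A : Subset n} (up : UpSet Q) (dec : Decomp₂ P Q A) where
    A⊆Q : A ⊆ Q
    A⊆Q = proj₁ (proj₁ dec)

    A-down : ∀ u v → v ∈ A → u ∈ Q → R u v → u ∈ A
    A-down = proj₂ (proj₁ dec)

    maxima-chain : ∀ u v → IsMaximalIn P A u → IsMaximalIn P (Q ─ A) v → ch u ≤ ch v
    maxima-chain = proj₁ (proj₂ (proj₂ (proj₂ dec)))

    minima-chain : ∀ u v → IsMinimalIn P A u → IsMinimalIn P (Q ─ A) v → ch u ≤ ch v
    minima-chain = proj₂ (proj₂ (proj₂ (proj₂ dec)))

    rest-up : UpSet (Q ─ A)
    rest-up x∈B x≤y =
      let x∈Q , x∉A = x∈p─q⁻ Q A x∈B
      in  x∈p∧x∉q⇒x∈p─q (up x∈Q x≤y) (λ y∈A → x∉A (A-down _ _ y∈A x∈Q x≤y))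

    -- If u ∈ A lies below v ∈ Q ─ A, then some w ∈ A on the chain of v satisfies u ≤ w ≤ v.
    -- (Take w maximal in A above u with ch v ≤ ch w; the maxima condition forces ch w = ch v.)
    through-A-on-chain : ∀ {u v} → u ∈ A → v ∈ Q ─ A → R u v →
                         ∃ λ w → w ∈ A × R u w × R w v × chain w ≡ chain v
    through-A-on-chain {u} {v} u∈A v∈B u≤v
      with maximal-above (_∈ Q ─ A) (_∈? Q ─ A) v∈B
         | maximal-above (λ x → x ∈ A × R u x × ch v ≤ ch x)
             (λ x → (x ∈? A) ×-dec (u ≤? x) ×-dec (ch v ℕ.≤? ch x)) (u∈A , R-refl , chain-antitone u≤v)
    ... | z , z∈B , v≤z , z-max | x , (x∈A , u≤x , chv≤chx) , _ , x-max =
      x , x∈A , u≤x , x≤v , same-chain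
      where
      chx≤chv : ch x ≤ ch v
      chx≤chv = ℕP.≮⇒≥ λ chv<chx →
        [ x-not-maximal chv<chx , x-not-covered chv<chx ]′ (maximal-or-covered (_∈ A) (_∈? A) x∈A)
        where
        -- x maximal in A would give ch x ≤ ch z ≤ ch v by the maxima condition.
        x-not-maximal : ch v < ch x → ¬ (∀ w → w ∈ A → R x w → w ≡ x)
        x-not-maximal chv<chx x-maxA =
          ℕP.<⇒≱ chv<chx (ℕP.≤-trans (maxima-chain x z (x∈A , x-maxA) (z∈B , z-max)) (chain-antitone v≤z))
        -- a cover y of x inside A would still satisfy ch v ≤ ch y, contradicting the choice of x.
        x-not-covered : ch v < ch x → ¬ (∃ λ y → Covers R x y × ∃ λ w → w ∈ A × R y w)
        x-not-covered chv<chx (y , x⋖y@(x≤y , x≢y , _) , w , w∈A , y≤w) =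
          x≢y (sym (x-max y (y∈A , R-trans u≤x x≤y , chv≤chy) x≤y))
          where
          y∈A : y ∈ A
          y∈A = A-down y w w∈A (up (A⊆Q x∈A) x≤y) y≤w
          chv≤chy : ch v ≤ ch y
          chv≤chy = ℕP.≤-pred (ℕP.<-≤-trans chv<chx (proj₂ (cover-chain x⋖y)))
      same-chain : chain x ≡ chain v
      same-chain = toℕ-injective (ℕP.≤-antisym chx≤chv chv≤chx)
      x≤v : R x v
      x≤v with chainIsChain x v same-chain
      ... | inj₁ x≤v = x≤v
      ... | inj₂ v≤x = contradiction (A-down v x x∈A (proj₁ (x∈p─q⁻ Q A v∈B)) v≤x) (proj₂ (x∈p─q⁻ Q A v∈B))

    -- Dually, if x ∈ A lies below u ∈ Q ─ A, then some y ∈ Q ─ A on the chain of x satisfies x ≤ y ≤ u.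
    -- (Take y minimal in Q ─ A below u with ch y ≤ ch x; the minima condition forces ch y = ch x.)
    through-rest-on-chain : ∀ {x u} → x ∈ A → u ∈ Q ─ A → R x u →
                            ∃ λ y → y ∈ Q ─ A × R x y × R y u × chain y ≡ chain x
    through-rest-on-chain {x} {u} x∈A u∈B x≤u
      with minimal-below (_∈ A) (_∈? A) x∈A
         | minimal-below (λ y → y ∈ Q ─ A × R y u × ch y ≤ ch x)
             (λ y → (y ∈? Q ─ A) ×-dec (y ≤? u) ×-dec (ch y ℕ.≤? ch x)) (u∈B , R-refl , chain-antitone x≤u)
    ... | a , a∈A , a≤x , a-min | y , (y∈B , y≤u , chy≤chx) , _ , y-min =
      y , y∈B , x≤y , y≤u , same-chain
      where
      chx≤chy : ch x ≤ ch y
      chx≤chy = ℕP.≮⇒≥ λ chy<chx →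
        [ y-not-minimal chy<chx , y-not-covering chy<chx ]′ (minimal-or-covering (_∈ Q ─ A) (_∈? Q ─ A) y∈B)
        where
        -- y minimal in Q ─ A would give ch x ≤ ch a ≤ ch y by the minima condition.
        y-not-minimal : ch y < ch x → ¬ (∀ w → w ∈ Q ─ A → R w y → w ≡ y)
        y-not-minimal chy<chx y-minB =
          ℕP.<⇒≱ chy<chx (ℕP.≤-trans (chain-antitone a≤x) (minima-chain a y (a∈A , a-min) (y∈B , y-minB)))
        -- an element z ⋖ y of Q ─ A would still satisfy ch z ≤ ch x, contradicting the choice of y.
        y-not-covering : ch y < ch x → ¬ (∃ λ z → Covers R z y × ∃ λ w → w ∈ Q ─ A × R w z)
        y-not-covering chy<chx (z , z⋖y@(z≤y , z≢y , _) , w , w∈B , w≤z) =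
          z≢y (y-min z (z∈B , R-trans z≤y y≤u , chz≤chx) z≤y)
          where
          z∈B : z ∈ Q ─ A
          z∈B = rest-up w∈B w≤z
          chz≤chx : ch z ≤ ch x
          chz≤chx = ℕP.≤-trans (proj₂ (cover-chain z⋖y)) chy<chx
      same-chain : chain y ≡ chain x
      same-chain = toℕ-injective (ℕP.≤-antisym chy≤chx chx≤chy)
      x≤y : R x y
      x≤y with chainIsChain x y (sym same-chain)
      ... | inj₁ x≤y = x≤y
      ... | inj₂ y≤x = contradiction (A-down y x x∈A (proj₁ (x∈p─q⁻ Q A y∈B)) y≤x) (proj₂ (x∈p─q⁻ Q A y∈B))

module Components {n m : ℕ} (P : TwoColorGridPoset n m) where
  open TwoColorGridPoset P
  open IsDecPartialOrder isDecPO using (_≤?_)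
    renaming (isPartialOrder to R-isPO; refl to R-refl; trans to R-trans)
  open FinitePoset R-isPO _≤?_ using (minimal-below)

  -- The ideals of Q in comp_γ(s) are exactly those agreeing with s off the color γ;
  -- this invariant is what a γ-colored cover cannot change.
  Agrees : Subset n → Color → Subset n → Subset n → Set
  Agrees Q γ s t = IsIdeal P Q t × (∀ u → color u ≢ γ → (u ∈ t → u ∈ s) × (u ∈ s → u ∈ t))

  self-agrees : ∀ {Q γ s} → IsIdeal P Q s → Agrees Q γ s s
  self-agrees s-ideal = s-ideal , λ _ _ → (λ u∈s → u∈s) , (λ u∈s → u∈s)

  off-color-not-added : ∀ {γ u x t} → color u ≡ γ → color x ≢ γ → x ∈ t ∪ ⁅ u ⁆ → x ∈ t
  off-color-not-added {u = u} {t = t} cu≡γ cx≢γ x∈ with x∈p∪⁅y⁆⁻ t u x∈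
  ... | inj₁ x∈t = x∈t
  ... | inj₂ refl = contradiction cu≡γ cx≢γ

  step-agrees : ∀ {Q γ s t t'} → Step P Q γ t t' → Agrees Q γ s t → Agrees Q γ s t'
  step-agrees (inj₁ (u , (_ , t'-ideal , _ , refl) , cu≡γ)) (_ , agree) = t'-ideal , λ x cx≢γ →
    (λ x∈t' → proj₁ (agree x cx≢γ) (off-color-not-added cu≡γ cx≢γ x∈t')) ,
    (λ x∈s → x∈p⇒x∈p∪⁅y⁆ u (proj₂ (agree x cx≢γ) x∈s))
  step-agrees (inj₂ (u , (t'-ideal , _ , _ , refl) , cu≡γ)) (_ , agree) = t'-ideal , λ x cx≢γ →
    (λ x∈t' → proj₁ (agree x cx≢γ) (x∈p⇒x∈p∪⁅y⁆ u x∈t')) ,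
    (λ x∈s → off-color-not-added cu≡γ cx≢γ (proj₂ (agree x cx≢γ) x∈s))

  comp-agrees : ∀ {Q γ s t t'} → InComp P Q γ t t' → Agrees Q γ s t → Agrees Q γ s t'
  comp-agrees {Q} {γ} {s} = fold (λ t t' → Agrees Q γ s t → Agrees Q γ s t')
    (λ step rest agree → rest (step-agrees step agree)) (λ agree → agree)

  -- If t ⊆ t' both agree with s, adding a minimal element u of t' ─ t to t is a γ-colored
  -- cover of J(Q): u has color γ since t and t' differ at u, and t ∪ ⁅ u ⁆ is an ideal since
  -- everything in Q below u lies in t' and, by minimality, in t unless it is u itself.
  add-minimal : ∀ {Q γ s t t' u} → Agrees Q γ s t → Agrees Q γ s t' → t ⊆ t' → u ∈ t' ─ t →
                (∀ w → w ∈ t' ─ t → R w u → w ≡ u) → Step P Q γ t (t ∪ ⁅ u ⁆)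
  add-minimal {Q} {γ} {s} {t} {t'} {u} ((t⊆Q , t-down) , agree) ((t'⊆Q , t'-down) , agree') t⊆t' u∈t'─t u-min =
    inj₁ (u , ((t⊆Q , t-down) , ((λ y∈ → t'⊆Q (∪⁅⁆-⊆ t⊆t' u∈t' y∈)) , down) , u∉t , refl) , u-colored)
    where
    u∈t' = proj₁ (x∈p─q⁻ t' t u∈t'─t)
    u∉t  = proj₂ (x∈p─q⁻ t' t u∈t'─t)

    u-colored : color u ≡ γ
    u-colored = decidable-stable (color u ≟ᶜ γ)
      (λ cu≢γ → u∉t (proj₂ (agree u cu≢γ) (proj₁ (agree' u cu≢γ) u∈t')))

    down : ∀ w v → v ∈ t ∪ ⁅ u ⁆ → w ∈ Q → R w v → w ∈ t ∪ ⁅ u ⁆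
    down w v v∈ w∈Q w≤v with x∈p∪⁅y⁆⁻ t u v∈ | w ∈? t
    ... | inj₁ v∈t  | _       = x∈p⇒x∈p∪⁅y⁆ u (t-down w v v∈t w∈Q w≤v)
    ... | inj₂ _    | yes w∈t = x∈p⇒x∈p∪⁅y⁆ u w∈t
    ... | inj₂ refl | no  w∉t =
      subst (_∈ t ∪ ⁅ u ⁆) (sym (u-min w (x∈p∧x∉q⇒x∈p─q (t'-down w v u∈t' w∈Q w≤v) w∉t) w≤v)) (y∈p∪⁅y⁆ u)

  -- Conversely to comp-agrees: if t ⊆ t' both agree with s, then t' ∈ comp_γ(t), reached by
  -- repeatedly adding a minimal element of t' ─ t (induction on ∣ t' ─ t ∣).
  connect : ∀ {Q γ s t t'} → Agrees Q γ s t → Agrees Q γ s t' → t ⊆ t' → InComp P Q γ t t'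
  connect {Q} {γ} {s} {t₀} {t'} agree₀ agree' = grow (<-wellFounded ∣ t' ─ t₀ ∣) agree₀
    where
    grow : ∀ {t} → Acc _<_ ∣ t' ─ t ∣ → Agrees Q γ s t → t ⊆ t' → InComp P Q γ t t'
    grow {t} (acc smaller) agree t⊆t' with nonempty? (t' ─ t)
    ... | no  t'─t-empty = subst (InComp P Q γ t) (⊆-antisym t⊆t' (─-empty⇒⊆ t'─t-empty)) ε
    ... | yes (x , x∈t'─t) with minimal-below (_∈ t' ─ t) (_∈? t' ─ t) x∈t'─t
    ... | u , u∈t'─t , _ , u-min =
      step ◅ grow (smaller shrinks) (step-agrees step agree) (∪⁅⁆-⊆ t⊆t' (proj₁ (x∈p─q⁻ t' t u∈t'─t)))
      where
      step : Step P Q γ t (t ∪ ⁅ u ⁆)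
      step = add-minimal agree agree' t⊆t' u∈t'─t u-min
      shrinks : ∣ t' ─ (t ∪ ⁅ u ⁆) ∣ < ∣ t' ─ t ∣
      shrinks = subst (λ r → ∣ r ∣ < ∣ t' ─ t ∣) (p─q─r≡p─q∪r t' t ⁅ u ⁆) (x∈p⇒∣p-x∣<∣p∣ u∈t'─t)

  -- The least member of comp_γ(s): elements of Q below some element of s not colored γ.
  BelowOffColor : Subset n → Color → Subset n → Fin n → Set
  BelowOffColor Q γ s u = u ∈ Q × ∃ λ v → v ∈ s × color v ≢ γ × R u v

  belowOffColor? : ∀ Q γ s → Decidable (BelowOffColor Q γ s)
  belowOffColor? Q γ s u = (u ∈? Q) ×-dec any? (λ v → (v ∈? s) ×-dec ¬? (color v ≟ᶜ γ) ×-dec (u ≤? v))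

  minIdeal : Subset n → Color → Subset n → Subset n
  minIdeal Q γ s = subsetOf (belowOffColor? Q γ s)

  -- The greatest member of comp_γ(s): elements of Q all of whose predecessors in Q
  -- not colored γ lie in s.
  OffColorBelowIn : Subset n → Color → Subset n → Fin n → Set
  OffColorBelowIn Q γ s u = u ∈ Q × (∀ v → v ∈ Q → R v u → color v ≢ γ → v ∈ s)

  offColorBelowIn? : ∀ Q γ s → Decidable (OffColorBelowIn Q γ s)
  offColorBelowIn? Q γ s u = (u ∈? Q) ×-dec
    all? (λ v → (v ∈? Q) →-dec (v ≤? u) →-dec ¬? (color v ≟ᶜ γ) →-dec (v ∈? s))

  maxIdeal : Subset n → Color → Subset n → Subset n
  maxIdeal Q γ s = subsetOf (offColorBelowIn? Q γ s)

  minIdeal⁺ : ∀ {Q γ s u} → BelowOffColor Q γ s u → u ∈ minIdeal Q γ s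
  minIdeal⁺ {Q} {γ} {s} = ∈subsetOf⁺ (belowOffColor? Q γ s)

  minIdeal⁻ : ∀ {Q γ s u} → u ∈ minIdeal Q γ s → BelowOffColor Q γ s u
  minIdeal⁻ {Q} {γ} {s} = ∈subsetOf⁻ (belowOffColor? Q γ s)

  maxIdeal⁺ : ∀ {Q γ s u} → OffColorBelowIn Q γ s u → u ∈ maxIdeal Q γ s
  maxIdeal⁺ {Q} {γ} {s} = ∈subsetOf⁺ (offColorBelowIn? Q γ s)

  maxIdeal⁻ : ∀ {Q γ s u} → u ∈ maxIdeal Q γ s → OffColorBelowIn Q γ s u
  maxIdeal⁻ {Q} {γ} {s} = ∈subsetOf⁻ (offColorBelowIn? Q γ s)

  minIdeal-agrees : ∀ {Q γ s} → IsIdeal P Q s → Agrees Q γ s (minIdeal Q γ s)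
  minIdeal-agrees {Q} {γ} {s} (s⊆Q , s-down) = ((λ u∈ → proj₁ (minIdeal⁻ u∈)) , down) , agree
    where
    down : ∀ w v → v ∈ minIdeal Q γ s → w ∈ Q → R w v → w ∈ minIdeal Q γ s
    down w v v∈ w∈Q w≤v =
      let _ , y , y∈s , cy≢γ , v≤y = minIdeal⁻ v∈ in minIdeal⁺ (w∈Q , y , y∈s , cy≢γ , R-trans w≤v v≤y)
    agree : ∀ u → color u ≢ γ → (u ∈ minIdeal Q γ s → u ∈ s) × (u ∈ s → u ∈ minIdeal Q γ s)
    agree u cu≢γ =
      (λ u∈ → let u∈Q , v , v∈s , _ , u≤v = minIdeal⁻ u∈ in s-down u v v∈s u∈Q u≤v) ,
      (λ u∈s → minIdeal⁺ (s⊆Q u∈s , u , u∈s , cu≢γ , R-refl))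

  maxIdeal-agrees : ∀ {Q γ s} → IsIdeal P Q s → Agrees Q γ s (maxIdeal Q γ s)
  maxIdeal-agrees {Q} {γ} {s} (s⊆Q , s-down) = ((λ u∈ → proj₁ (maxIdeal⁻ u∈)) , down) , agree
    where
    down : ∀ w v → v ∈ maxIdeal Q γ s → w ∈ Q → R w v → w ∈ maxIdeal Q γ s
    down w v v∈ w∈Q w≤v =
      let _ , below-v = maxIdeal⁻ v∈ in maxIdeal⁺ (w∈Q , λ y y∈Q y≤w → below-v y y∈Q (R-trans y≤w w≤v))
    agree : ∀ u → color u ≢ γ → (u ∈ maxIdeal Q γ s → u ∈ s) × (u ∈ s → u ∈ maxIdeal Q γ s)
    agree u cu≢γ =
      (λ u∈ → let u∈Q , below-u = maxIdeal⁻ u∈ in below-u u u∈Q R-refl cu≢γ) ,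
      (λ u∈s → maxIdeal⁺ (s⊆Q u∈s , λ v v∈Q v≤u _ → s-down v u u∈s v∈Q v≤u))

  minIdeal⊆ : ∀ {Q γ s t} → Agrees Q γ s t → minIdeal Q γ s ⊆ t
  minIdeal⊆ ((_ , t-down) , agree) u∈ =
    let u∈Q , v , v∈s , cv≢γ , u≤v = minIdeal⁻ u∈ in t-down _ v (proj₂ (agree v cv≢γ) v∈s) u∈Q u≤v

  ⊆maxIdeal : ∀ {Q γ s t} → Agrees Q γ s t → t ⊆ maxIdeal Q γ s
  ⊆maxIdeal ((t⊆Q , t-down) , agree) {u} u∈t =
    maxIdeal⁺ (t⊆Q u∈t , λ v v∈Q v≤u cv≢γ → proj₁ (agree v cv≢γ) (t-down v u u∈t v∈Q v≤u))

  minIdeal-reached : ∀ {Q γ s} → IsIdeal P Q s → InComp P Q γ s (minIdeal Q γ s)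
  minIdeal-reached s-ideal = reverse Sum.swap
    (connect (minIdeal-agrees s-ideal) (self-agrees s-ideal) (minIdeal⊆ (self-agrees s-ideal)))

  maxIdeal-reached : ∀ {Q γ s} → IsIdeal P Q s → InComp P Q γ s (maxIdeal Q γ s)
  maxIdeal-reached s-ideal =
    connect (self-agrees s-ideal) (maxIdeal-agrees s-ideal) (⊆maxIdeal (self-agrees s-ideal))

  minSize : ∀ {Q γ s} → IsIdeal P Q s → IsMinSize P Q γ s ∣ minIdeal Q γ s ∣
  minSize s-ideal = (_ , minIdeal-reached s-ideal , refl) ,
    λ t s~t → p⊆q⇒∣p∣≤∣q∣ (minIdeal⊆ (comp-agrees s~t (self-agrees s-ideal)))

  maxSize : ∀ {Q γ s} → IsIdeal P Q s → IsMaxSize P Q γ s ∣ maxIdeal Q γ s ∣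
  maxSize s-ideal = (_ , maxIdeal-reached s-ideal , refl) ,
    λ t s~t → p⊆q⇒∣p∣≤∣q∣ (⊆maxIdeal (comp-agrees s~t (self-agrees s-ideal)))

  minSize-unique : ∀ {Q γ s k k'} → IsMinSize P Q γ s k → IsMinSize P Q γ s k' → k ≡ k'
  minSize-unique {k = k} {k'} ((u , s~u , ∣u∣≡k) , k-low) ((u' , s~u' , ∣u'∣≡k') , k'-low) =
    ℕP.≤-antisym (subst (k ≤_) ∣u'∣≡k' (k-low u' s~u')) (subst (k' ≤_) ∣u∣≡k (k'-low u s~u))

  maxSize-unique : ∀ {Q γ s K K'} → IsMaxSize P Q γ s K → IsMaxSize P Q γ s K' → K ≡ K'
  maxSize-unique {K = K} {K'} ((u , s~u , ∣u∣≡K) , K-high) ((u' , s~u' , ∣u'∣≡K') , K'-high) =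
    ℕP.≤-antisym (subst (_≤ K') ∣u∣≡K (K'-high u s~u)) (subst (_≤ K) ∣u'∣≡K' (K-high u' s~u'))

  ρ : Subset n → Color → Subset n → ℕ
  ρ Q γ s = ∣ s ∣ ∸ ∣ minIdeal Q γ s ∣

  len : Subset n → Color → Subset n → ℕ
  len Q γ s = ∣ maxIdeal Q γ s ∣ ∸ ∣ minIdeal Q γ s ∣

  -- The subtractions in ρ and len are not truncated.
  ∣minIdeal∣≤∣s∣ : ∀ {Q γ s} → IsIdeal P Q s → ∣ minIdeal Q γ s ∣ ≤ ∣ s ∣
  ∣minIdeal∣≤∣s∣ s-ideal = p⊆q⇒∣p∣≤∣q∣ (minIdeal⊆ (self-agrees s-ideal))

  ∣minIdeal∣≤∣maxIdeal∣ : ∀ {Q γ s} → IsIdeal P Q s → ∣ minIdeal Q γ s ∣ ≤ ∣ maxIdeal Q γ s ∣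
  ∣minIdeal∣≤∣maxIdeal∣ s-ideal = p⊆q⇒∣p∣≤∣q∣ (⊆maxIdeal (minIdeal-agrees s-ideal))

  ρ-isRho : ∀ {Q γ s} → IsIdeal P Q s → IsRho P Q γ s (ρ Q γ s)
  ρ-isRho s-ideal = _ , minSize s-ideal , ℕP.m∸n+n≡m (∣minIdeal∣≤∣s∣ s-ideal)

  isRho⇒ρ : ∀ {Q γ s r} → IsIdeal P Q s → IsRho P Q γ s r → r ≡ ρ Q γ s
  isRho⇒ρ {r = r} s-ideal (k , k-min , r+k≡∣s∣) = begin
    r              ≡⟨ ℕP.m+n∸n≡m r k ⟨
    r + k ∸ k      ≡⟨ cong₂ _∸_ r+k≡∣s∣ (minSize-unique k-min (minSize s-ideal)) ⟩
    ρ _ _ _        ∎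
    where open ≡-Reasoning

  len-isLen : ∀ {Q γ s} → IsIdeal P Q s → IsLen P Q γ s (len Q γ s)
  len-isLen s-ideal = _ , _ , minSize s-ideal , maxSize s-ideal , ℕP.m∸n+n≡m (∣minIdeal∣≤∣maxIdeal∣ s-ideal)

  isLen⇒len : ∀ {Q γ s l} → IsIdeal P Q s → IsLen P Q γ s l → l ≡ len Q γ s
  isLen⇒len {l = l} s-ideal (k , K , k-min , K-max , l+k≡K) = begin
    l              ≡⟨ ℕP.m+n∸n≡m l k ⟨
    l + k ∸ k      ≡⟨ cong₂ _∸_ (trans l+k≡K (maxSize-unique K-max (maxSize s-ideal)))
                                (minSize-unique k-min (minSize s-ideal)) ⟩
    len _ _ _      ∎
    where open ≡-Reasoning

module Additivity {n m : ℕ} (P : TwoColorGridPoset n m) where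
  open TwoColorGridPoset P
  open Grid P
  open Components P

  ideal-restrict : ∀ {Q X s} → IsIdeal P Q s → X ⊆ Q → IsIdeal P X (s ∩ X)
  ideal-restrict {Q} {X} {s} (s⊆Q , s-down) X⊆Q =
    (λ x∈ → proj₂ (x∈p∩q⁻ s X x∈)) ,
    λ u v v∈ u∈X u≤v → x∈p∩q⁺ (s-down u v (proj₁ (x∈p∩q⁻ s X v∈)) (X⊆Q u∈X) u≤v , u∈X)

  module Restriction {Q A : Subset n} (up : UpSet Q) (dec : Decomp₂ P Q A)
                     {γ : Color} {s : Subset n} (s-ideal : IsIdeal P Q s) where
    open TwoPieces up dec
    private
      s⊆Q = proj₁ s-ideal
      s-down = proj₂ s-ideal
      B = Q ─ A

    s─A : s ─ A ≡ s ∩ B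
    s─A = ⊆-antisym
      (λ x∈ → let x∈s , x∉A = x∈p─q⁻ s A x∈ in x∈p∩q⁺ (x∈s , x∈p∧x∉q⇒x∈p─q (s⊆Q x∈s) x∉A))
      (λ x∈ → let x∈s , x∈B = x∈p∩q⁻ s B x∈ in x∈p∧x∉q⇒x∈p─q x∈s (proj₂ (x∈p─q⁻ Q A x∈B)))

    -- An element of A below an off-γ element of s is already below one in s ∩ A,
    -- found on the same chain (hence of the same color).
    minIdeal∩A : minIdeal Q γ s ∩ A ≡ minIdeal A γ (s ∩ A)
    minIdeal∩A = ⊆-antisym to from
      where
      to : minIdeal Q γ s ∩ A ⊆ minIdeal A γ (s ∩ A)
      to {u} u∈ with x∈p∩q⁻ (minIdeal Q γ s) A u∈
      ... | u∈min , u∈A with minIdeal⁻ u∈min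
      ... | u∈Q , v , v∈s , cv≢γ , u≤v with v ∈? A
      ... | yes v∈A = minIdeal⁺ (u∈A , v , x∈p∩q⁺ (v∈s , v∈A) , cv≢γ , u≤v)
      ... | no  v∉A with through-A-on-chain u∈A (x∈p∧x∉q⇒x∈p─q (s⊆Q v∈s) v∉A) u≤v
      ... | w , w∈A , u≤w , w≤v , same-chain =
        minIdeal⁺ (u∈A , w , x∈p∩q⁺ (s-down w v v∈s (A⊆Q w∈A) w≤v , w∈A) ,
                   (λ cw≡γ → cv≢γ (trans (sym (colorConst w v same-chain)) cw≡γ)) , u≤w)
      from : minIdeal A γ (s ∩ A) ⊆ minIdeal Q γ s ∩ A
      from u∈ = let u∈A , v , v∈s∩A , cv≢γ , u≤v = minIdeal⁻ u∈ in
        x∈p∩q⁺ (minIdeal⁺ (A⊆Q u∈A , v , proj₁ (x∈p∩q⁻ s A v∈s∩A) , cv≢γ , u≤v) , u∈A)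

    -- Anything below an element of s ∩ A lies in A, so the part of minIdeal outside A
    -- only sees s ∩ (Q ─ A).
    minIdeal─A : minIdeal Q γ s ─ A ≡ minIdeal B γ (s ∩ B)
    minIdeal─A = ⊆-antisym to from
      where
      to : minIdeal Q γ s ─ A ⊆ minIdeal B γ (s ∩ B)
      to u∈ with x∈p─q⁻ (minIdeal Q γ s) A u∈
      ... | u∈min , u∉A with minIdeal⁻ u∈min
      ... | u∈Q , v , v∈s , cv≢γ , u≤v =
        minIdeal⁺ (x∈p∧x∉q⇒x∈p─q u∈Q u∉A , v ,
                   x∈p∩q⁺ (v∈s , x∈p∧x∉q⇒x∈p─q (s⊆Q v∈s) (λ v∈A → u∉A (A-down _ v v∈A u∈Q u≤v))) ,
                   cv≢γ , u≤v)
      from : minIdeal B γ (s ∩ B) ⊆ minIdeal Q γ s ─ A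
      from u∈ = let u∈B , v , v∈s∩B , cv≢γ , u≤v = minIdeal⁻ u∈ ; u∈Q , u∉A = x∈p─q⁻ Q A u∈B in
        x∈p∧x∉q⇒x∈p─q (minIdeal⁺ (u∈Q , v , proj₁ (x∈p∩q⁻ s B v∈s∩B) , cv≢γ , u≤v)) u∉A

    -- Everything below an element of A lies in A, so maxIdeal ∩ A only sees s ∩ A.
    maxIdeal∩A : maxIdeal Q γ s ∩ A ≡ maxIdeal A γ (s ∩ A)
    maxIdeal∩A = ⊆-antisym to from
      where
      to : maxIdeal Q γ s ∩ A ⊆ maxIdeal A γ (s ∩ A)
      to u∈ with x∈p∩q⁻ (maxIdeal Q γ s) A u∈
      ... | u∈max , u∈A = let _ , below-u = maxIdeal⁻ u∈max in
        maxIdeal⁺ (u∈A , λ v v∈A v≤u cv≢γ → x∈p∩q⁺ (below-u v (A⊆Q v∈A) v≤u cv≢γ , v∈A))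
      from : maxIdeal A γ (s ∩ A) ⊆ maxIdeal Q γ s ∩ A
      from {u} u∈ = let u∈A , below-u = maxIdeal⁻ u∈ in
        x∈p∩q⁺ (maxIdeal⁺ (A⊆Q u∈A , λ v v∈Q v≤u cv≢γ →
          proj₁ (x∈p∩q⁻ s A (below-u v (A-down v u u∈A v∈Q v≤u) v≤u cv≢γ))) , u∈A)

    -- An off-γ element v ∈ A below u ∈ Q ─ A lies below an element of Q ─ A on its own
    -- chain that is still below u; so maxIdeal ─ A only sees s ∩ (Q ─ A).
    maxIdeal─A : maxIdeal Q γ s ─ A ≡ maxIdeal B γ (s ∩ B)
    maxIdeal─A = ⊆-antisym to from
      where
      to : maxIdeal Q γ s ─ A ⊆ maxIdeal B γ (s ∩ B)
      to u∈ with x∈p─q⁻ (maxIdeal Q γ s) A u∈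
      ... | u∈max , u∉A = let u∈Q , below-u = maxIdeal⁻ u∈max in
        maxIdeal⁺ (x∈p∧x∉q⇒x∈p─q u∈Q u∉A , λ v v∈B v≤u cv≢γ →
          x∈p∩q⁺ (below-u v (proj₁ (x∈p─q⁻ Q A v∈B)) v≤u cv≢γ , v∈B))
      from : maxIdeal B γ (s ∩ B) ⊆ maxIdeal Q γ s ─ A
      from {u} u∈ with maxIdeal⁻ u∈
      ... | u∈B , below-u = x∈p∧x∉q⇒x∈p─q (maxIdeal⁺ (proj₁ (x∈p─q⁻ Q A u∈B) , below)) (proj₂ (x∈p─q⁻ Q A u∈B))
        where
        below : ∀ v → v ∈ Q → R v u → color v ≢ γ → v ∈ s
        below v v∈Q v≤u cv≢γ with v ∈? A
        ... | no  v∉A = proj₁ (x∈p∩q⁻ s B (below-u v (x∈p∧x∉q⇒x∈p─q v∈Q v∉A) v≤u cv≢γ))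
        ... | yes v∈A with through-rest-on-chain v∈A u∈B v≤u
        ... | y , y∈B , v≤y , y≤u , same-chain =
          s-down v y (proj₁ (x∈p∩q⁻ s B (below-u y y∈B y≤u
            (λ cy≡γ → cv≢γ (trans (sym (colorConst y v same-chain)) cy≡γ))))) v∈Q v≤y

  Additive : (Subset n → Subset n → ℕ) → Set
  Additive F = ∀ {Q A s} → UpSet Q → Decomp₂ P Q A → IsIdeal P Q s →
               F Q s ≡ F A (s ∩ A) + F (Q ─ A) (s ∩ (Q ─ A))

  size-additive : Additive (λ _ s → ∣ s ∣)
  size-additive {Q} {A} {s} up dec s-ideal = ∣p∣-split refl (Restriction.s─A up dec {α} s-ideal)

  ∣minIdeal∣-additive : ∀ γ → Additive (λ Q s → ∣ minIdeal Q γ s ∣)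
  ∣minIdeal∣-additive γ up dec s-ideal = ∣p∣-split minIdeal∩A minIdeal─A
    where open Restriction up dec {γ} s-ideal

  ∣maxIdeal∣-additive : ∀ γ → Additive (λ Q s → ∣ maxIdeal Q γ s ∣)
  ∣maxIdeal∣-additive γ up dec s-ideal = ∣p∣-split maxIdeal∩A maxIdeal─A
    where open Restriction up dec {γ} s-ideal

  ∸-additive : ∀ {F G} → (∀ {Q s} → IsIdeal P Q s → G Q s ≤ F Q s) →
               Additive F → Additive G → Additive (λ Q s → F Q s ∸ G Q s)
  ∸-additive {F} {G} G≤F F-add G-add {Q} {A} {s} up dec s-ideal = begin
    F Q s ∸ G Q s                       ≡⟨ cong₂ _∸_ (F-add up dec s-ideal) (G-add up dec s-ideal) ⟩
    (a + b) ∸ (c + d)                   ≡⟨ ℕP.∸-+-assoc (a + b) c d ⟨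
    (a + b) ∸ c ∸ d                     ≡⟨ cong (_∸ d) (ℕP.+-∸-comm b (G≤F (ideal-restrict s-ideal A⊆Q))) ⟩
    (a ∸ c + b) ∸ d                     ≡⟨ ℕP.+-∸-assoc (a ∸ c) (G≤F (ideal-restrict s-ideal (p─q⊆p Q A))) ⟩
    (a ∸ c) + (b ∸ d)                   ∎
    where
    open ≡-Reasoning
    open TwoPieces up dec using (A⊆Q)
    a = F A (s ∩ A)
    b = F (Q ─ A) (s ∩ (Q ─ A))
    c = G A (s ∩ A)
    d = G (Q ─ A) (s ∩ (Q ─ A))

  ρ-additive : ∀ γ → Additive (λ Q s → ρ Q γ s)
  ρ-additive γ = ∸-additive ∣minIdeal∣≤∣s∣ size-additive (∣minIdeal∣-additive γ)

  len-additive : ∀ γ → Additive (λ Q s → len Q γ s)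
  len-additive γ = ∸-additive ∣minIdeal∣≤∣maxIdeal∣ (∣maxIdeal∣-additive γ) (∣minIdeal∣-additive γ)

  piece⊆ : ∀ {k Q} {Ps : Vec (Subset n) k} → Decomp P Q Ps → ∀ i → lookup Ps i ⊆ Q
  piece⊆ {Ps = A ∷ B ∷ []}     (dec , refl) zero          = proj₁ (proj₁ dec)
  piece⊆ {Q = Q} {A ∷ B ∷ []}  (dec , refl) (suc zero)    = p─q⊆p Q A
  piece⊆ {Ps = A ∷ B ∷ C ∷ Ps} (dec , rest) zero          = proj₁ (proj₁ dec)
  piece⊆ {Q = Q} {A ∷ B ∷ C ∷ Ps} (dec , rest) (suc i)    = p─q⊆p Q A ∘ piece⊆ rest i

  sum-over-pieces : ∀ {F} → Additive F → ∀ {k Q s} {Ps : Vec (Subset n) k} →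
                    UpSet Q → Decomp P Q Ps → IsIdeal P Q s →
                    F Q s ≡ sumℕ (λ i → F (lookup Ps i) (s ∩ lookup Ps i))
  sum-over-pieces {F} F-add {s = s} {A ∷ B ∷ []} up (dec , refl) s-ideal =
    trans (F-add up dec s-ideal) (cong (F A (s ∩ A) +_) (sym (ℕP.+-identityʳ _)))
  sum-over-pieces {F} F-add {suc k} {Q} {s} {A ∷ B ∷ C ∷ Ps} up (dec , rest) s-ideal = begin
    F Q s                                                  ≡⟨ F-add up dec s-ideal ⟩
    F A (s ∩ A) + F (Q ─ A) (s ∩ (Q ─ A))                  ≡⟨ cong (F A (s ∩ A) +_) (sum-over-pieces F-add
                                                                (TwoPieces.rest-up up dec) rest
                                                                (ideal-restrict s-ideal (p─q⊆p Q A))) ⟩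
    F A (s ∩ A) + sumℕ (λ i → F (piece i) ((s ∩ (Q ─ A)) ∩ piece i))
                                                           ≡⟨ cong (F A (s ∩ A) +_) (sumℕ-cong λ i →
                                                                cong (F (piece i)) (∩-⊆-absorb s (piece⊆ rest i))) ⟩
    F A (s ∩ A) + sumℕ (λ i → F (piece i) (s ∩ piece i))   ∎
    where
    open ≡-Reasoning
    piece : Fin k → Subset n
    piece = lookup (B ∷ C ∷ Ps)

module Weights {n m : ℕ} (P : TwoColorGridPoset n m) where
  open TwoColorGridPoset P
  open Grid P
  open Components P
  open Additivity P

  wt : Subset n → Subset n → ℤ × ℤ
  wt Q s = (wtPart (ρ Q α s) (len Q α s) , wtPart (ρ Q β s) (len Q β s))

  wt-isWt : ∀ {Q s} → IsIdeal P Q s → IsWt P Q s (wt Q s)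
  wt-isWt s-ideal = _ , _ , _ , _ , ρ-isRho s-ideal , len-isLen s-ideal , ρ-isRho s-ideal , len-isLen s-ideal ,
                    refl , refl

  isWt⇒wt : ∀ {Q s w} → IsIdeal P Q s → IsWt P Q s w → w ≡ wt Q s
  isWt⇒wt {w = x , y} s-ideal (rα , lα , rβ , lβ , is-rα , is-lα , is-rβ , is-lβ , x≡ , y≡) = cong₂ _,_
    (trans x≡ (cong₂ wtPart (isRho⇒ρ s-ideal is-rα) (isLen⇒len s-ideal is-lα)))
    (trans y≡ (cong₂ wtPart (isRho⇒ρ s-ideal is-rβ) (isLen⇒len s-ideal is-lβ)))

  wt-split : ∀ {Q A s} → UpSet Q → Decomp₂ P Q A → IsIdeal P Q s →
             wt Q s ≡ wt A (s ∩ A) ⊕ wt (Q ─ A) (s ∩ (Q ─ A))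
  wt-split {Q} {A} {s} up dec s-ideal = cong₂ _,_ (split α) (split β)
    where
    B = Q ─ A
    split : ∀ γ → wtPart (ρ Q γ s) (len Q γ s) ≡
                  wtPart (ρ A γ (s ∩ A)) (len A γ (s ∩ A)) ℤ.+ wtPart (ρ B γ (s ∩ B)) (len B γ (s ∩ B))
    split γ = trans (cong₂ wtPart (ρ-additive γ up dec s-ideal) (len-additive γ up dec s-ideal))
                    (wtPart-+ (ρ A γ (s ∩ A)) (ρ B γ (s ∩ B)) (len A γ (s ∩ A)) (len B γ (s ∩ B)))

  wt-sum : ∀ {k Q s} {Ps : Vec (Subset n) k} → UpSet Q → Decomp P Q Ps → IsIdeal P Q s →
           wt Q s ≡ sumWt (λ i → wt (lookup Ps i) (s ∩ lookup Ps i))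
  wt-sum {k} {s = s} {Ps} up dec s-ideal = trans
    (cong₂ _,_ (cong₂ wtPart (sum-over-pieces (ρ-additive α) up dec s-ideal) (sum-over-pieces (len-additive α) up dec s-ideal))
               (cong₂ wtPart (sum-over-pieces (ρ-additive β) up dec s-ideal) (sum-over-pieces (len-additive β) up dec s-ideal)))
    (sym (sumWt-wtPart (statistic ρ α) (statistic len α) (statistic ρ β) (statistic len β)))
    where
    statistic : (Subset n → Color → Subset n → ℕ) → Color → Fin k → ℕ
    statistic F γ i = F (lookup Ps i) γ (s ∩ lookup Ps i)

  Shifts : Subset n → (Color → Color → ℤ) → Set
  Shifts Q M = ∀ s t u γ → JCover P Q s t u → color u ≡ γ → wt Q t ≡ wt Q s ⊕ (M γ α , M γ β)

  structCond⇒shifts : ∀ {Q} M → StructCond P Q M → Shifts Q M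
  structCond⇒shifts M sc s t u γ cover@(s-ideal , t-ideal , _) cu≡γ =
    let x'≡ , y'≡ = sc s t u γ cover cu≡γ _ _ _ _ (wt-isWt s-ideal) (wt-isWt t-ideal) in cong₂ _,_ x'≡ y'≡

  shifts⇒structCond : ∀ {Q} M → Shifts Q M → StructCond P Q M
  shifts⇒structCond {Q} M shifts s t u γ cover@(s-ideal , t-ideal , _) cu≡γ x y x' y' s-wt t-wt =
    cong proj₁ shifted , cong proj₂ shifted
    where
    shifted : (x' , y') ≡ (x , y) ⊕ (M γ α , M γ β)
    shifted = trans (isWt⇒wt t-ideal t-wt)
                    (trans (shifts s t u γ cover cu≡γ) (cong (_⊕ (M γ α , M γ β)) (sym (isWt⇒wt s-ideal s-wt))))

  cover-inside : ∀ {Q X s t u} → JCover P Q s t u → X ⊆ Q → u ∈ X → JCover P X (s ∩ X) (t ∩ X) u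
  cover-inside {s = s} (s-ideal , t-ideal , u∉s , refl) X⊆Q u∈X =
    ideal-restrict s-ideal X⊆Q , ideal-restrict t-ideal X⊆Q , (λ u∈ → u∉s (proj₁ (x∈p∩q⁻ s _ u∈))) ,
    ∪⁅⁆-∩-inside s u∈X

  added-element : ∀ {Q s t u} → JCover P Q s t u → u ∈ Q
  added-element {u = u} (_ , (t⊆Q , _) , _ , refl) = t⊆Q (y∈p∪⁅y⁆ u)

  cover-outside : ∀ {Q X s t u} → JCover P Q s t u → u ∉ X → t ∩ X ≡ s ∩ X
  cover-outside {s = s} (_ , _ , _ , refl) u∉X = ∪⁅⁆-∩-outside s u∉X

  -- The structure condition passes from A and Q ─ A to Q: a cover of J(Q) moves exactly one piece.
  shifts-split : ∀ {Q A} M → UpSet Q → Decomp₂ P Q A → Shifts A M → Shifts (Q ─ A) M → Shifts Q M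
  shifts-split {Q} {A} M up dec shifts-A shifts-B s t u γ cover@(s-ideal , t-ideal , _) cu≡γ
    with u ∈? A
  ... | yes u∈A = begin
    wt Q t                                    ≡⟨ wt-split up dec t-ideal ⟩
    wt A (t ∩ A) ⊕ wt B (t ∩ B)               ≡⟨ cong₂ _⊕_ (shifts-A _ _ u γ (cover-inside cover A⊆Q u∈A) cu≡γ)
                                                            (cong (wt B) (cover-outside cover (λ u∈B → proj₂ (x∈p─q⁻ Q A u∈B) u∈A))) ⟩
    (wt A (s ∩ A) ⊕ c) ⊕ wt B (s ∩ B)         ≡⟨ ⊕-swapʳ (wt A (s ∩ A)) (wt B (s ∩ B)) c ⟩
    (wt A (s ∩ A) ⊕ wt B (s ∩ B)) ⊕ c         ≡⟨ cong (_⊕ c) (wt-split up dec s-ideal) ⟨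
    wt Q s ⊕ c                                ∎
    where
    open ≡-Reasoning
    open TwoPieces up dec using (A⊆Q)
    B = Q ─ A
    c = (M γ α , M γ β)
  ... | no u∉A = begin
    wt Q t                                    ≡⟨ wt-split up dec t-ideal ⟩
    wt A (t ∩ A) ⊕ wt B (t ∩ B)               ≡⟨ cong₂ _⊕_ (cong (wt A) (cover-outside cover u∉A))
                                                            (shifts-B _ _ u γ (cover-inside cover (p─q⊆p Q A) u∈B) cu≡γ) ⟩
    wt A (s ∩ A) ⊕ (wt B (s ∩ B) ⊕ c)         ≡⟨ ⊕-assoc (wt A (s ∩ A)) (wt B (s ∩ B)) c ⟨
    (wt A (s ∩ A) ⊕ wt B (s ∩ B)) ⊕ c         ≡⟨ cong (_⊕ c) (wt-split up dec s-ideal) ⟨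
    wt Q s ⊕ c                                ∎
    where
    open ≡-Reasoning
    B = Q ─ A
    c = (M γ α , M γ β)
    u∈B = x∈p∧x∉q⇒x∈p─q (added-element cover) u∉A

  shifts-decomp : ∀ {k Q} M {Ps : Vec (Subset n) k} → UpSet Q → Decomp P Q Ps →
                  (∀ i → Shifts (lookup Ps i) M) → Shifts Q M
  shifts-decomp M {A ∷ B ∷ []} up (dec , refl) shifts =
    shifts-split M up dec (shifts zero) (shifts (suc zero))
  shifts-decomp M {A ∷ B ∷ C ∷ Ps} up (dec , rest) shifts =
    shifts-split M up dec (shifts zero) (shifts-decomp M (TwoPieces.rest-up up dec) rest (shifts ∘ suc))

module Pieces {n m k : ℕ} (P : TwoColorGridPoset n m) {Q : Subset n} {Ps : Vec (Subset n) k}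
              (up : Grid.UpSet P Q) (dec : Decomp P Q Ps) where
  open Components P
  open Additivity P
  open Weights P

  piece-ideal : ∀ {s} → IsIdeal P Q s → ∀ i → IsIdeal P (lookup Ps i) (s ∩ lookup Ps i)
  piece-ideal s-ideal i = ideal-restrict s-ideal (piece⊆ dec i)

  ρ-sum : ∀ {s} → IsIdeal P Q s → ∀ γ r (rs : Fin k → ℕ) → IsRho P Q γ s r →
          (∀ i → IsRho P (lookup Ps i) γ (s ∩ lookup Ps i) (rs i)) → r ≡ sumℕ rs
  ρ-sum s-ideal γ r rs r-is rs-are =
    trans (isRho⇒ρ s-ideal r-is) (trans (sum-over-pieces (ρ-additive γ) up dec s-ideal)
          (sumℕ-cong λ i → sym (isRho⇒ρ (piece-ideal s-ideal i) (rs-are i))))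

  len-sum : ∀ {s} → IsIdeal P Q s → ∀ γ l (ls : Fin k → ℕ) → IsLen P Q γ s l →
            (∀ i → IsLen P (lookup Ps i) γ (s ∩ lookup Ps i) (ls i)) → l ≡ sumℕ ls
  len-sum s-ideal γ l ls l-is ls-are =
    trans (isLen⇒len s-ideal l-is) (trans (sum-over-pieces (len-additive γ) up dec s-ideal)
          (sumℕ-cong λ i → sym (isLen⇒len (piece-ideal s-ideal i) (ls-are i))))

  weight-sum : ∀ {s} → IsIdeal P Q s → ∀ w (ws : Fin k → ℤ × ℤ) → IsWt P Q s w →
               (∀ i → IsWt P (lookup Ps i) (s ∩ lookup Ps i) (ws i)) → w ≡ sumWt ws
  weight-sum s-ideal w ws w-is ws-are =
    trans (isWt⇒wt s-ideal w-is) (trans (wt-sum up dec s-ideal)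
          (sumWt-cong λ i → sym (isWt⇒wt (piece-ideal s-ideal i) (ws-are i))))

  structCond-inherited : ∀ M → (∀ i → StructCond P (lookup Ps i) M) → StructCond P Q M
  structCond-inherited M sc =
    shifts⇒structCond M (shifts-decomp M up dec λ i → structCond⇒shifts M (sc i))

lemma3p1 : ∀ {n m k} (P : TwoColorGridPoset n m) (Ps : Vec (Subset n) k) →
    Decomp P ⊤ Ps →
      -- (1) ρ_γ and l_γ are additive over the pieces
      (∀ (s : Subset n) → IsIdeal P ⊤ s → ∀ (γ : Color) →
          (∀ (r : ℕ) (rs : Fin k → ℕ) → IsRho P ⊤ γ s r →
             (∀ i → IsRho P (lookup Ps i) γ (s ∩ lookup Ps i) (rs i)) →
             r ≡ sumℕ rs)
        × (∀ (l : ℕ) (ls : Fin k → ℕ) → IsLen P ⊤ γ s l →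
             (∀ i → IsLen P (lookup Ps i) γ (s ∩ lookup Ps i) (ls i)) →
             l ≡ sumℕ ls))
      -- (1) wt is additive over the pieces
    × (∀ (s : Subset n) → IsIdeal P ⊤ s →
          ∀ (w : ℤ × ℤ) (ws : Fin k → ℤ × ℤ) → IsWt P ⊤ s w →
          (∀ i → IsWt P (lookup Ps i) (s ∩ lookup Ps i) (ws i)) →
          w ≡ sumWt ws)
      -- (2) structure condition is inherited
    × (∀ (M : Color → Color → ℤ) →
          (∀ i → StructCond P (lookup Ps i) M) → StructCond P ⊤ M)
lemma3p1 P Ps dec =
  (λ s s-ideal γ → ρ-sum s-ideal γ , len-sum s-ideal γ) ,
  (λ s s-ideal → weight-sum s-ideal) ,
  structCond-inherited
  where
  open Pieces P (Grid.⊤-up P) dec
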